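{- Let $n,m$ be positive integers and $\mathbf a,\mathbf b\in\{0,1\}^n$. If the $(\mathbf a,\mathbf b)$-entry of $(A_n)^m$ is positive, then so is the $(\mathbf a,\mathbf b)$-entry of $(A_n)^{m+1}$. Furthermore, the $(\mathbf a,\mathbf b)$-entry of $(A_n)^m$ is positive if and only if $\mathbf a\trianglerighteq_z\mathbf b$ for some $z\le m$.
   Context: $\chi(\mathbf v)$ is the $0/1$ vector with the same support as $\mathbf v$; $\mathbf v\trianglerighteq\mathbf w$ means $\sum_{j\le i}v_j\ge\sum_{j\le i}w_j$ for all $i$. $z$-domination: for $\mathbf v,\mathbf w\in\mathbb N^n$ with $\mathbf v\trianglerighteq\mathbf w$ and $\chi(\mathbf v)\trianglerighteq\chi(\mathbf w)$, let $Z_{\mathbf v}=\{i:v_i=0\}$, $Z_{\mathbf w}=\{i:w_i=0\}$ and build a matching $M\subseteq Z_{\mathbf v}\times Z_{\mathbf w}$ by repeatedly taking the largest unmatched $i\in Z_{\mathbf v}$ and matching it to the largest unmatched $j\in Z_{\mathbf w}$ with $j\le i$, until all of $Z_{\mathbf v}$ is matched. With $z=\max\{1,\max\{i-j:(i,j)\in M\}\}$ (and $z=1$ if $M=\emptyset$), write $\mathbf v\trianglerighteq_z\mathbf w$. (The statement $\mathbf v\trianglerighteq_z\mathbf w$ presupposes $\mathbf v\trianglerighteq\mathbf w$ and $\chi(\mathbf v)\trianglerighteq\chi(\mathbf w)$.) $A_n$ is the $2^n\times2^n$ matrix with rows and columns indexed by $\{0,1\}^n$, whose $(\mathbf j,\mathbf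 k)$-entry is $1$ if $\mathbf j\trianglerighteq_1\mathbf k$ and $0$ otherwise. -}

module Defs where

open import Data.Nat using (ℕ; zero; suc; _+_; _*_; _∸_; _⊔_; _≤_; _≤ᵇ_)
open import Data.Nat.Properties using (_≤?_) renaming (_≟_ to _≟ℕ_)
open import Data.Bool using (Bool; true; false; if_then_else_)
open import Data.List using (List; []; _∷_; reverse; zip; map; concatMap)
open import Data.Nat.ListAction using (sum)
open import Data.List.Relation.Unary.All using (All; all?)
open import Data.Vec using (Vec; []; _∷_; toList)
import Data.Vec as V
open import Data.Vec.Properties using () renaming (≡-dec to vec-≡-dec)
open import Data.Bool.Properties using () renaming (_≟_ to _≟B_)
open import Data.Maybe using (Maybe; just; nothing)
import Data.Maybe as M
open import Data.Maybe.Properties using () renaming (≡-dec to maybe-≡-dec)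
open import Data.Product using (_×_; _,_; proj₁; proj₂)
open import Relation.Binary.PropositionalEquality using (_≡_)
open import Relation.Nullary using (Dec; yes; no; _×-dec_)
open import Relation.Nullary.Decidable using (⌊_⌋)

-- Vectors in ℕ^n; positions are numbered 1..n.

χ : ∀ {n} → Vec ℕ n → Vec ℕ n
χ = V.map (λ { zero → 0 ; (suc _) → 1 })

prefixSums : List ℕ → List ℕ
prefixSums = go 0
  where
  go : ℕ → List ℕ → List ℕ
  go acc [] = []
  go acc (x ∷ xs) = (acc + x) ∷ go (acc + x) xs

_⊵_ : ∀ {n} → Vec ℕ n → Vec ℕ n → Set
v ⊵ w = All (λ p → proj₂ p ≤ proj₁ p) (zip (prefixSums (toList v)) (prefixSums (toList w)))

_⊵?_ : ∀ {n} (v w : Vec ℕ n) → Dec (v ⊵ w)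
v ⊵? w = all? (λ p → proj₂ p ≤? proj₁ p) _

zerosFrom : ℕ → List ℕ → List ℕ
zerosFrom k [] = []
zerosFrom k (zero ∷ xs) = k ∷ zerosFrom (suc k) xs
zerosFrom k (suc _ ∷ xs) = zerosFrom (suc k) xs

zerosDesc : ∀ {n} → Vec ℕ n → List ℕ
zerosDesc v = reverse (zerosFrom 1 (toList v))

pick : ℕ → List ℕ → Maybe (ℕ × List ℕ)
pick i [] = nothing
pick i (j ∷ js) = if j ≤ᵇ i then just (j , js)
                  else M.map (λ p → proj₁ p , j ∷ proj₂ p) (pick i js)

matchGap : List ℕ → List ℕ → Maybe ℕ
matchGap [] ws = just 0
matchGap (i ∷ is) ws with pick i ws
... | nothing = nothing
... | just (j , ws') = M.map (λ g → (i ∸ j) ⊔ g) (matchGap is ws')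

zValue : ∀ {n} → Vec ℕ n → Vec ℕ n → Maybe ℕ
zValue v w = M.map (1 ⊔_) (matchGap (zerosDesc v) (zerosDesc w))

ZDom : ∀ {n} → ℕ → Vec ℕ n → Vec ℕ n → Set
ZDom z v w = (v ⊵ w) × (χ v ⊵ χ w) × (zValue v w ≡ just z)

ZDom? : ∀ {n} (z : ℕ) (v w : Vec ℕ n) → Dec (ZDom z v w)
ZDom? z v w = (v ⊵? w) ×-dec ((χ v ⊵? χ w) ×-dec maybe-≡-dec _≟ℕ_ (zValue v w) (just z))

toℕVec : ∀ {n} → Vec Bool n → Vec ℕ n
toℕVec = V.map (λ { false → 0 ; true → 1 })

allBin : (n : ℕ) → List (Vec Bool n)
allBin zero = [] ∷ []
allBin (suc n) = concatMap (λ v → (false ∷ v) ∷ (true ∷ v) ∷ []) (allBin n)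

Mat : ℕ → Set
Mat n = Vec Bool n → Vec Bool n → ℕ

_⊗_ : ∀ {n} → Mat n → Mat n → Mat n
_⊗_ {n} M N a b = sum (map (λ c → M a c * N c b) (allBin n))

idMat : ∀ {n} → Mat n
idMat a b = if ⌊ vec-≡-dec _≟B_ a b ⌋ then 1 else 0

_^^_ : ∀ {n} → Mat n → ℕ → Mat n
M ^^ zero = idMat
M ^^ suc m = (M ^^ m) ⊗ M

A : (n : ℕ) → Mat n
A n j k = if ⌊ ZDom? 1 (toℕVec j) (toℕVec k) ⌋ then 1 else 0

module Submission where

-- For 0/1 vectors the prefix-sum conditions of ⊵_z hold automatically once the zeros of a are
-- matched, in order, to zeros of b at or to the left of them, and the greedy matching succeeds,
-- with the least possible z, whenever such a matching exists. So a ⊵_z b for some z ≤ m iff the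
-- zeros of a can be matched in order to zeros of b, each moving left by at most m positions
-- ("lag m"). Matchings of lags m and k compose to one of lag k + m, and conversely a matching of
-- lag k + m factors through the vector whose zeros sit at min(p, r + k) for the matched pairs
-- (p, r). As (A_n^(m+1))(a, b) > 0 iff (A_n^m)(a, c) > 0 and A_n(c, b) > 0 for some c, the entry
-- (A_n^m)(a, b) is positive iff a lag-m matching exists, and that is monotone in m.

open import Defs
open import Data.Nat using (ℕ; zero; suc; _+_; _*_; _∸_; _⊔_; _⊓_; _≤_; _<_; _≥_; _>_; _≤ᵇ_; z≤n; s≤s)
open import Data.Nat.Properties
open import Data.Nat.ListAction using (sum)
open import Data.Bool using (Bool; true; false; if_then_else_; T)
open import Data.Bool.Properties using () renaming (_≟_ to _≟B_)
open import Data.List using (List; []; _∷_; _++_; _ʳ++_; reverse; drop; zip; map)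
open import Data.List.Membership.Propositional using (_∈_; lose)
open import Data.List.Membership.Propositional.Properties using (∈-concatMap⁺)
open import Data.List.Relation.Unary.All using (All; []; _∷_)
import Data.List.Relation.Unary.All as All
open import Data.List.Relation.Unary.All.Properties using (All¬⇒¬Any)
open import Data.List.Relation.Unary.AllPairs using (AllPairs; []; _∷_)
open import Data.List.Relation.Unary.Any using (Any; here; there)
import Data.List.Relation.Unary.Any as Any
open import Data.List.Relation.Binary.Sublist.Heterogeneous using (Sublist; []; _∷ʳ_; _∷_; toAny)
import Data.List.Relation.Binary.Sublist.Heterogeneous as Sublist
import Data.List.Relation.Binary.Sublist.Heterogeneous.Properties as Sublistₚ
open import Data.Vec using (Vec; []; _∷_; toList)
open import Data.Vec.Properties using () renaming (≡-dec to vec-≡-dec)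
open import Data.Maybe using (just)
import Data.Maybe as Maybe
open import Data.Maybe.Properties using (just-injective)
open import Data.Product using (_×_; _,_; proj₁; proj₂; ∃; ∃₂)
open import Data.Sum using (_⊎_; inj₁; inj₂)
open import Data.Empty using (⊥-elim)
open import Function using (flip; _∘_)
open import Function.Bundles using (_⇔_; mk⇔; Equivalence)
open import Function.Properties.Equivalence using () renaming (trans to ⇔-trans)
open import Relation.Binary.PropositionalEquality using (_≡_; refl; sym; cong; subst; subst₂)
open import Relation.Nullary using (¬_; Dec; yes; no)
open import Relation.Nullary.Decidable using (⌊_⌋)

private variable
  k m n z : ℕ

Lag : ℕ → ℕ → ℕ → Set
Lag z p q = q ≤ p × p ≤ q + z

Lag-mono : ∀ {z z' p q} → z ≤ z' → Lag z p q → Lag z' p q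
Lag-mono z≤z' (q≤p , p≤q+z) = q≤p , ≤-trans p≤q+z (+-monoʳ-≤ _ z≤z')

Lag-trans : ∀ {p q r} → Lag m p q → Lag k q r → Lag (k + m) p r
Lag-trans {m} {k} {p} {q} {r} (q≤p , p≤q+m) (r≤q , q≤r+k) = ≤-trans r≤q q≤p , (begin
  p           ≤⟨ p≤q+m ⟩
  q + m       ≤⟨ +-monoˡ-≤ m q≤r+k ⟩
  r + k + m   ≡⟨ +-assoc r k m ⟩
  r + (k + m) ∎)
  where open ≤-Reasoning

-- Among the admissible intermediate positions between r and p we take the largest one,
-- which keeps the interpolated positions strictly increasing.
Lag-split : ∀ {p r} → Lag (k + m) p r → Lag m p (p ⊓ (r + k)) × Lag k (p ⊓ (r + k)) r
Lag-split {k} {m} {p} {r} (r≤p , p≤r+k+m) =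
  (m⊓n≤m p (r + k) , p≤q+m) , ⊓-glb r≤p (m≤m+n r k) , m⊓n≤n p (r + k)
  where
  p≤q+m : p ≤ p ⊓ (r + k) + m
  p≤q+m = begin
    p                        ≤⟨ ⊓-glb (m≤m+n p m) (≤-trans p≤r+k+m (≤-reflexive (sym (+-assoc r k m)))) ⟩
    (p + m) ⊓ (r + k + m)    ≡⟨ sym (+-distribʳ-⊓ m p (r + k)) ⟩
    p ⊓ (r + k) + m          ∎
    where open ≤-Reasoning

module _ {A : Set} {R : A → A → Set} where

  AllPairs-reverse : ∀ {xs} → AllPairs R xs → AllPairs (flip R) (reverse xs)
  AllPairs-reverse Rxs = go [] Rxs [] (All.universal (λ _ → []) _)
    where
    go : ∀ {xs} acc → AllPairs R xs → AllPairs (flip R) acc →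
         All (λ x → All (λ a → R a x) acc) xs → AllPairs (flip R) (xs ʳ++ acc)
    go acc [] Racc _ = Racc
    go acc (Rx ∷ Rxs) Racc (x>acc ∷ xs>acc) =
      go _ Rxs (x>acc ∷ Racc) (All.zipWith (λ (Rxy , y>acc) → Rxy ∷ y>acc) (Rx , xs>acc))

  All-remove : ∀ {P : A → Set} pre {y post} → All P (pre ++ y ∷ post) → All P (pre ++ post)
  All-remove [] (_ ∷ Ppost) = Ppost
  All-remove (_ ∷ pre) (Px ∷ Prest) = Px ∷ All-remove pre Prest

  AllPairs-remove : ∀ pre {y post} → AllPairs R (pre ++ y ∷ post) → AllPairs R (pre ++ post)
  AllPairs-remove [] (_ ∷ Rpost) = Rpost
  AllPairs-remove (_ ∷ pre) (Rx ∷ Rrest) = All-remove pre Rx ∷ AllPairs-remove pre Rrest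

pick-split : ∀ {i} ws {j ws'} → pick i ws ≡ just (j , ws') →
  ∃₂ λ pre post → ws ≡ pre ++ j ∷ post × ws' ≡ pre ++ post × j ≤ i × All (i <_) pre
pick-split {i} (y ∷ ys) eq with y ≤ᵇ i in y≤ᵇi
pick-split {i} (y ∷ ys) refl | true = [] , ys , refl , refl , ≤ᵇ⇒≤ y i (subst T (sym y≤ᵇi) _) , []
pick-split {i} (y ∷ ys) eq | false with pick i ys in pick≡
pick-split {i} (y ∷ ys) refl | false | just _ with pick-split ys pick≡
... | pre , post , refl , refl , j≤i , i<pre =
  y ∷ pre , post , refl , refl , j≤i , ≰⇒> (λ y≤i → subst T y≤ᵇi (≤⇒≤ᵇ y≤i)) ∷ i<pre

pick-AllPairs : ∀ {R i ws j ws'} → AllPairs R ws → pick i ws ≡ just (j , ws') → AllPairs R ws'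
pick-AllPairs {ws = ws} Rws eq with pick-split ws eq
... | pre , _ , refl , refl , _ = AllPairs-remove pre Rws

matchGap-∷⁻ : ∀ i is ws {g} → matchGap (i ∷ is) ws ≡ just g →
  ∃₂ λ j ws' → pick i ws ≡ just (j , ws') × ∃ λ g' → matchGap is ws' ≡ just g' × g ≡ (i ∸ j) ⊔ g'
matchGap-∷⁻ i is ws eq with pick i ws
... | just (j , ws') with matchGap is ws' in match≡
...   | just g' = j , ws' , refl , g' , match≡ , sym (just-injective eq)

matchGap-∷⁺ : ∀ i is ws {j ws' g'} → pick i ws ≡ just (j , ws') → matchGap is ws' ≡ just g' →
  matchGap (i ∷ is) ws ≡ just ((i ∸ j) ⊔ g')
matchGap-∷⁺ i is ws pick≡ match≡ rewrite pick≡ | match≡ = refl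

Lag-skip : ∀ {i xs} pre {ys} → All (_< i) xs → All (i <_) pre →
  Sublist (Lag z) xs (pre ++ ys) → Sublist (Lag z) xs ys
Lag-skip [] _ _ s = s
Lag-skip (_ ∷ pre) xs<i (_ ∷ i<pre) (_ ∷ʳ s) = Lag-skip pre xs<i i<pre s
Lag-skip (_ ∷ pre) (x<i ∷ _) (i<q ∷ _) ((q≤x , _) ∷ _) = ⊥-elim (<⇒≱ (<-trans x<i i<q) q≤x)

matchGap-sound : ∀ {is ws g} → AllPairs _>_ is → matchGap is ws ≡ just g → Sublist (Lag g) is ws
matchGap-sound {[]} {ws} [] refl = Sublistₚ.Sublist-[]-universal ws
matchGap-sound {i ∷ is} {ws} (is<i ∷ is-sorted) eq with matchGap-∷⁻ i is ws eq
... | j , ws' , pick≡ , g' , match≡ , refl with pick-split ws pick≡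
... | pre , post , refl , refl , j≤i , i<pre =
  Sublistₚ.++ˡ pre ((j≤i , i≤j+g) ∷ Sublist.map (Lag-mono (m≤n⊔m (i ∸ j) g'))
    (Lag-skip pre is<i i<pre (matchGap-sound is-sorted match≡)))
  where
  i≤j+g : i ≤ j + ((i ∸ j) ⊔ g')
  i≤j+g = ≤-trans (m≤n+m∸n i j) (+-monoʳ-≤ j (m≤m⊔n (i ∸ j) g'))

Lag-bound : ∀ {i y ys} → Any (Lag z i) ys → All (_≤ y) ys → i ≤ y + z
Lag-bound {z} (here (_ , i≤q+z)) (q≤y ∷ _) = ≤-trans i≤q+z (+-monoˡ-≤ z q≤y)
Lag-bound (there lag) (_ ∷ ys≤y) = Lag-bound lag ys≤y

pick-complete : ∀ {i is} ws → AllPairs _>_ ws → Sublist (Lag z) (i ∷ is) ws →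
  ∃₂ λ j ws' → pick i ws ≡ just (j , ws') × i ≤ j + z × Sublist (Lag z) is ws'
pick-complete {i = i} (y ∷ ys) (ys<y ∷ ys-sorted) s with y ≤ᵇ i in y≤ᵇi
... | true = y , ys , refl , Lag-bound (toAny s) (≤-refl ∷ All.map <⇒≤ ys<y) , Sublistₚ.∷⁻ s
... | false with s
...   | (y≤i , _) ∷ _ = ⊥-elim (subst T y≤ᵇi (≤⇒≤ᵇ y≤i))
...   | _ ∷ʳ s' with pick-complete ys ys-sorted s'
...     | j , ws' , pick≡ , i≤j+z , rest rewrite pick≡ = j , y ∷ ws' , refl , i≤j+z , y ∷ʳ rest

matchGap-complete : ∀ {is ws} → AllPairs _>_ ws → Sublist (Lag z) is ws →
  ∃ λ g → matchGap is ws ≡ just g × g ≤ z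
matchGap-complete {is = []} _ _ = 0 , refl , z≤n
matchGap-complete {is = i ∷ is} {ws} ws-sorted s with pick-complete ws ws-sorted s
... | j , ws' , pick≡ , i≤j+z , rest with matchGap-complete (pick-AllPairs ws-sorted pick≡) rest
... | g' , match≡ , g'≤z = (i ∸ j) ⊔ g' , matchGap-∷⁺ i is ws pick≡ match≡ , ⊔-lub (m≤n+o⇒m∸n≤o i j i≤j+z) g'≤z

zerosFrom-≥ : ∀ k xs → All (k ≤_) (zerosFrom k xs)
zerosFrom-≥ k [] = []
zerosFrom-≥ k (zero ∷ xs) = ≤-refl ∷ All.map <⇒≤ (zerosFrom-≥ (suc k) xs)
zerosFrom-≥ k (suc _ ∷ xs) = All.map <⇒≤ (zerosFrom-≥ (suc k) xs)

zerosFrom-< : ∀ k (v : Vec ℕ n) → All (_< k + n) (zerosFrom k (toList v))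
zerosFrom-< k [] = []
zerosFrom-< {suc n} k (x ∷ v) rewrite +-suc k n with x
... | zero = s≤s (m≤m+n k n) ∷ zerosFrom-< (suc k) v
... | suc _ = zerosFrom-< (suc k) v

zerosFrom-sorted : ∀ k xs → AllPairs _<_ (zerosFrom k xs)
zerosFrom-sorted k [] = []
zerosFrom-sorted k (zero ∷ xs) = zerosFrom-≥ (suc k) xs ∷ zerosFrom-sorted (suc k) xs
zerosFrom-sorted k (suc _ ∷ xs) = zerosFrom-sorted (suc k) xs

bits : Vec Bool n → List ℕ
bits a = toList (toℕVec a)

zeros : Vec Bool n → List ℕ
zeros a = zerosFrom 1 (bits a)

withZerosAt : ℕ → (n : ℕ) → List ℕ → Vec Bool n
withZerosAt k zero _ = []
withZerosAt k (suc n) [] = true ∷ withZerosAt (suc k) n []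
withZerosAt k (suc n) (q ∷ qs) with q ≟ k
... | yes _ = false ∷ withZerosAt (suc k) n qs
... | no _ = true ∷ withZerosAt (suc k) n (q ∷ qs)

zerosFrom-withZerosAt : ∀ k n qs → AllPairs _<_ qs → All (k ≤_) qs → All (_< k + n) qs →
  zerosFrom k (bits (withZerosAt k n qs)) ≡ qs
zerosFrom-withZerosAt k zero [] _ _ _ = refl
zerosFrom-withZerosAt k zero (q ∷ _) _ (k≤q ∷ _) (q<k+0 ∷ _) =
  ⊥-elim (<⇒≱ q<k+0 (≤-trans (≤-reflexive (+-identityʳ k)) k≤q))
zerosFrom-withZerosAt k (suc n) [] _ _ _ = zerosFrom-withZerosAt (suc k) n [] [] [] []
zerosFrom-withZerosAt k (suc n) (q ∷ qs) (q<qs ∷ qs-sorted) (k≤q ∷ k≤qs) qqs<k+1+n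
  rewrite +-suc k n with q ≟ k | qqs<k+1+n
... | yes refl | _ ∷ qs<k+1+n = cong (q ∷_) (zerosFrom-withZerosAt (suc k) n qs qs-sorted q<qs qs<k+1+n)
... | no q≢k | qqs<k+1+n' = zerosFrom-withZerosAt (suc k) n (q ∷ qs) (q<qs ∷ qs-sorted)
        (k<q ∷ All.map (<-trans k<q) q<qs) qqs<k+1+n'
  where
  k<q : k < q
  k<q = ≤∧≢⇒< k≤q (q≢k ∘ sym)

interpolate : ∀ k {m ps rs} → Sublist (Lag (k + m)) ps rs → List ℕ
interpolate k [] = []
interpolate k (_ ∷ʳ s) = interpolate k s
interpolate k {ps = p ∷ _} {r ∷ _} (_ ∷ s) = p ⊓ (r + k) ∷ interpolate k s

module _ (k : ℕ) {m : ℕ} where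

  interpolate-lagˡ : ∀ {ps rs} (s : Sublist (Lag (k + m)) ps rs) → Sublist (Lag m) ps (interpolate k s)
  interpolate-lagˡ [] = []
  interpolate-lagˡ (_ ∷ʳ s) = interpolate-lagˡ s
  interpolate-lagˡ (lag ∷ s) = proj₁ (Lag-split lag) ∷ interpolate-lagˡ s

  interpolate-lagʳ : ∀ {ps rs} (s : Sublist (Lag (k + m)) ps rs) → Sublist (Lag k) (interpolate k s) rs
  interpolate-lagʳ [] = []
  interpolate-lagʳ (r ∷ʳ s) = r ∷ʳ interpolate-lagʳ s
  interpolate-lagʳ (lag ∷ s) = proj₂ (Lag-split lag) ∷ interpolate-lagʳ s

  interpolate-All : ∀ {P Q U : ℕ → Set} → (∀ {p r} → Lag (k + m) p r → P p → Q r → U (p ⊓ (r + k))) →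
    ∀ {ps rs} (s : Sublist (Lag (k + m)) ps rs) → All P ps → All Q rs → All U (interpolate k s)
  interpolate-All f [] _ _ = []
  interpolate-All f (_ ∷ʳ s) Pps (_ ∷ Qrs) = interpolate-All f s Pps Qrs
  interpolate-All f (lag ∷ s) (Pp ∷ Pps) (Qr ∷ Qrs) = f lag Pp Qr ∷ interpolate-All f s Pps Qrs

  interpolate-sorted : ∀ {ps rs} (s : Sublist (Lag (k + m)) ps rs) →
    AllPairs _<_ ps → AllPairs _<_ rs → AllPairs _<_ (interpolate k s)
  interpolate-sorted [] _ _ = []
  interpolate-sorted (_ ∷ʳ s) ps-sorted (_ ∷ rs-sorted) = interpolate-sorted s ps-sorted rs-sorted
  interpolate-sorted (_ ∷ s) (p<ps ∷ ps-sorted) (r<rs ∷ rs-sorted) =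
    interpolate-All (λ _ p<p' r<r' → ⊓-mono-< p<p' (+-monoˡ-< k r<r')) s p<ps r<rs
    ∷ interpolate-sorted s ps-sorted rs-sorted

record ZeroMatch (z : ℕ) (a b : Vec Bool n) : Set where
  constructor zeroMatch
  field sublist : Sublist (Lag z) (zeros a) (zeros b)

ZeroMatch-mono : ∀ {z z'} {a b : Vec Bool n} → z ≤ z' → ZeroMatch z a b → ZeroMatch z' a b
ZeroMatch-mono z≤z' (zeroMatch s) = zeroMatch (Sublist.map (Lag-mono z≤z') s)

ZeroMatch-trans : ∀ {a b c : Vec Bool n} → ZeroMatch m a c → ZeroMatch k c b → ZeroMatch (k + m) a b
ZeroMatch-trans (zeroMatch s) (zeroMatch t) = zeroMatch (Sublistₚ.trans Lag-trans s t)

ZeroMatch-split : ∀ {a b : Vec Bool n} → ZeroMatch (k + m) a b →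
  ∃ λ c → ZeroMatch m a c × ZeroMatch k c b
ZeroMatch-split {n} {k} {m} {a} {b} (zeroMatch s) =
  withZerosAt 1 n qs , zeroMatch (subst (Sublist (Lag m) (zeros a)) (sym zeros-c) (interpolate-lagˡ k s))
                     , zeroMatch (subst (λ zs → Sublist (Lag k) zs (zeros b)) (sym zeros-c) (interpolate-lagʳ k s))
  where
  qs : List ℕ
  qs = interpolate k s
  qs-bounds : All (λ q → 1 ≤ q × q < 1 + n) qs
  qs-bounds = interpolate-All k
    (λ lag p<1+n 1≤r → ≤-trans 1≤r (proj₁ (proj₂ (Lag-split lag))) , ≤-<-trans (m⊓n≤m _ _) p<1+n)
    s (zerosFrom-< 1 (toℕVec a)) (zerosFrom-≥ 1 (bits b))
  zeros-c : zeros (withZerosAt 1 n qs) ≡ qs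
  zeros-c = zerosFrom-withZerosAt 1 n qs
    (interpolate-sorted k s (zerosFrom-sorted 1 (bits a)) (zerosFrom-sorted 1 (bits b)))
    (All.map proj₁ qs-bounds) (All.map proj₂ qs-bounds)

Dominates : List ℕ → List ℕ → Set
Dominates xs ys = All (λ p → proj₂ p ≤ proj₁ p) (zip (prefixSums xs) (prefixSums ys))

module _ {R : ℕ → ℕ → Set} where

  drop-Sublist-∷⁻ : ∀ j {xs y ys} → Sublist R (drop j xs) (y ∷ ys) →
    Sublist R (drop j xs) ys ⊎ Sublist R (drop (suc j) xs) ys
  drop-Sublist-∷⁻ zero (_ ∷ʳ s) = inj₁ s
  drop-Sublist-∷⁻ zero (_ ∷ s) = inj₂ s
  drop-Sublist-∷⁻ (suc j) {[]} (_ ∷ʳ s) = inj₁ s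
  drop-Sublist-∷⁻ (suc j) {_ ∷ xs} s = drop-Sublist-∷⁻ j s

unmatched-head : ∀ {x xs ys} → All (x <_) ys → ¬ Sublist _≥_ (x ∷ xs) ys
unmatched-head x<ys s = All¬⇒¬Any (All.map <⇒≱ x<ys) (toAny s)

surplus-step : ∀ t {s j x y j'} → t + j ≤ s → y + j' ≤ x + j → t + y + j' ≤ s + x
surplus-step t {s} {j} {x} {y} {j'} t+j≤s y+j'≤x+j = begin
  t + y + j'   ≡⟨ +-assoc t y j' ⟩
  t + (y + j') ≤⟨ +-monoʳ-≤ t y+j'≤x+j ⟩
  t + (x + j)  ≡⟨ cong (t +_) (+-comm x j) ⟩
  t + (j + x)  ≡⟨ +-assoc t j x ⟨
  t + j + x    ≤⟨ +-monoˡ-≤ x t+j≤s ⟩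
  s + x        ∎
  where open ≤-Reasoning

-- Scanning positions k, k+1, … with s and t the prefix sums so far: the next j zeros of a are
-- matched to zeros of b already passed, each of which added one to the surplus s − t.
dominates : ∀ k (a b : Vec Bool n) j {s t} → t + j ≤ s →
  Sublist _≥_ (drop j (zerosFrom k (bits a))) (zerosFrom k (bits b)) →
  Dominates (s ∷ bits a) (t ∷ bits b)
dominates k [] [] j t+j≤s _ = m+n≤o⇒m≤o _ t+j≤s ∷ []
dominates k (true ∷ a) (true ∷ b) j {t = t} t+j≤s sub =
  m+n≤o⇒m≤o _ t+j≤s ∷ dominates (suc k) a b j (surplus-step t t+j≤s ≤-refl) sub
dominates k (true ∷ a) (false ∷ b) j {t = t} t+j≤s sub with drop-Sublist-∷⁻ j sub
... | inj₁ sub' = m+n≤o⇒m≤o _ t+j≤s ∷ dominates (suc k) a b j (surplus-step t t+j≤s (n≤1+n j)) sub'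
... | inj₂ sub' = m+n≤o⇒m≤o _ t+j≤s ∷ dominates (suc k) a b (suc j) (surplus-step t t+j≤s ≤-refl) sub'
dominates k (false ∷ a) (true ∷ b) zero _ sub = ⊥-elim (unmatched-head (zerosFrom-≥ (suc k) (bits b)) sub)
dominates k (false ∷ a) (true ∷ b) (suc j) {t = t} t+j≤s sub =
  m+n≤o⇒m≤o _ t+j≤s ∷ dominates (suc k) a b j (surplus-step t t+j≤s ≤-refl) sub
dominates k (false ∷ a) (false ∷ b) zero {t = t} t+j≤s sub =
  m+n≤o⇒m≤o _ t+j≤s ∷ dominates (suc k) a b zero (surplus-step t t+j≤s ≤-refl) (Sublistₚ.∷⁻ sub)
dominates k (false ∷ a) (false ∷ b) (suc j) {t = t} t+j≤s sub with drop-Sublist-∷⁻ j sub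
... | inj₁ sub' = m+n≤o⇒m≤o _ t+j≤s ∷ dominates (suc k) a b j (surplus-step t t+j≤s (n≤1+n j)) sub'
... | inj₂ sub' = m+n≤o⇒m≤o _ t+j≤s ∷ dominates (suc k) a b (suc j) (surplus-step t t+j≤s ≤-refl) sub'

ZeroMatch⇒⊵ : ∀ {a b : Vec Bool n} → ZeroMatch z a b → toℕVec a ⊵ toℕVec b
ZeroMatch⇒⊵ {a = a} {b} (zeroMatch s) with dominates 1 a b 0 {0} {0} z≤n (Sublist.map proj₁ s)
... | _ ∷ a⊵b = a⊵b

χ-toℕVec : (a : Vec Bool n) → χ (toℕVec a) ≡ toℕVec a
χ-toℕVec [] = refl
χ-toℕVec (true ∷ a) = cong (1 ∷_) (χ-toℕVec a)
χ-toℕVec (false ∷ a) = cong (0 ∷_) (χ-toℕVec a)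

ZeroMatch⇒ZDom : ∀ {a b : Vec Bool n} → ZeroMatch m a b →
  ∃ λ g → g ≤ m × ZDom (1 ⊔ g) (toℕVec a) (toℕVec b)
ZeroMatch⇒ZDom {a = a} {b} (zeroMatch s)
  with matchGap-complete (AllPairs-reverse (zerosFrom-sorted 1 (bits b))) (Sublistₚ.reverse⁺ s)
... | g , match≡ , g≤m =
  g , g≤m , a⊵b , subst₂ _⊵_ (sym (χ-toℕVec a)) (sym (χ-toℕVec b)) a⊵b , cong (Maybe.map (1 ⊔_)) match≡
  where
  a⊵b : toℕVec a ⊵ toℕVec b
  a⊵b = ZeroMatch⇒⊵ (zeroMatch s)

ZDom⇒ZeroMatch : ∀ {a b : Vec Bool n} → z ≤ m → ZDom z (toℕVec a) (toℕVec b) → ZeroMatch m a b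
ZDom⇒ZeroMatch {a = a} {b} z≤m (_ , _ , zValue≡)
  with matchGap (reverse (zeros a)) (reverse (zeros b)) in match≡ | zValue≡
... | just g | refl = ZeroMatch-mono (≤-trans (m≤n⊔m 1 g) z≤m) (zeroMatch
  (Sublistₚ.reverse⁻ (matchGap-sound (AllPairs-reverse (zerosFrom-sorted 1 (bits a))) match≡)))

*-positive : ∀ {x y} → 0 < x * y ⇔ (0 < x × 0 < y)
*-positive {zero} = mk⇔ (λ ()) (λ ())
*-positive {suc x} {zero} = mk⇔ (λ 0<x*0 → ⊥-elim (<-irrefl (sym (*-zeroʳ x)) 0<x*0)) (λ ())
*-positive {suc x} {suc y} = mk⇔ (λ _ → s≤s z≤n , s≤s z≤n) (λ _ → s≤s z≤n)

sum-positive : ∀ {A : Set} (f : A → ℕ) xs → 0 < sum (map f xs) ⇔ Any (λ x → 0 < f x) xs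
sum-positive f xs = mk⇔ (to xs) from
  where
  to : ∀ xs → 0 < sum (map f xs) → Any (λ x → 0 < f x) xs
  to (x ∷ xs) 0<sum with f x in fx≡
  ... | suc _ = here (subst (0 <_) (sym fx≡) (s≤s z≤n))
  ... | zero = there (to xs 0<sum)
  from : ∀ {xs} → Any (λ x → 0 < f x) xs → 0 < sum (map f xs)
  from (here 0<fx) = ≤-trans 0<fx (m≤m+n _ _)
  from {x ∷ _} (there 0<f) = ≤-trans (from 0<f) (m≤n+m _ (f x))

allBin-complete : (v : Vec Bool n) → v ∈ allBin n
allBin-complete [] = here refl
allBin-complete (false ∷ v) = ∈-concatMap⁺ _ (Any.map (λ { refl → here refl }) (allBin-complete v))
allBin-complete (true ∷ v) = ∈-concatMap⁺ _ (Any.map (λ { refl → there (here refl) }) (allBin-complete v))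

⊗-positive : ∀ {M N : Mat n} {a b} → 0 < (M ⊗ N) a b ⇔ ∃ λ c → 0 < M a c × 0 < N c b
⊗-positive {n} {M} {N} {a} {b} = mk⇔
  (λ 0<MNab → let c , 0<MacNcb = Any.satisfied (Equivalence.to (sum-positive _ (allBin n)) 0<MNab)
              in c , Equivalence.to *-positive 0<MacNcb)
  (λ (c , 0<Mac , 0<Ncb) → Equivalence.from (sum-positive _ (allBin n))
     (lose (allBin-complete c) (Equivalence.from *-positive (0<Mac , 0<Ncb))))

indicator-positive : ∀ {P : Set} (P? : Dec P) → 0 < (if ⌊ P? ⌋ then 1 else 0) ⇔ P
indicator-positive (yes p) = mk⇔ (λ _ → p) (λ _ → s≤s z≤n)
indicator-positive (no ¬p) = mk⇔ (λ ()) (⊥-elim ∘ ¬p)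

ZeroMatch⇔ZDom : ∀ {a b : Vec Bool n} → 1 ≤ m →
  ZeroMatch m a b ⇔ ∃ λ z → z ≤ m × ZDom z (toℕVec a) (toℕVec b)
ZeroMatch⇔ZDom 1≤m = mk⇔
  (λ s → let g , g≤m , d = ZeroMatch⇒ZDom s in 1 ⊔ g , ⊔-lub 1≤m g≤m , d)
  (λ (_ , z≤m , d) → ZDom⇒ZeroMatch z≤m d)

A-positive : ∀ {a b : Vec Bool n} → 0 < A n a b ⇔ ZeroMatch 1 a b
A-positive {n} {a} {b} =
  ⇔-trans (indicator-positive (ZDom? 1 (toℕVec a) (toℕVec b))) (mk⇔ (ZDom⇒ZeroMatch ≤-refl) ZeroMatch⇒ZDom₁)
  where
  ZeroMatch⇒ZDom₁ : ZeroMatch 1 a b → ZDom 1 (toℕVec a) (toℕVec b)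
  ZeroMatch⇒ZDom₁ s with ZeroMatch⇒ZDom s
  ... | g , g≤1 , d = subst (λ z → ZDom z (toℕVec a) (toℕVec b)) (m≥n⇒m⊔n≡m g≤1) d

power-positive : ∀ m {a b : Vec Bool n} → 0 < (A n ^^ suc m) a b ⇔ ZeroMatch (suc m) a b
power-positive {n} zero {a} {b} = ⇔-trans (⊗-positive {M = idMat} {A n}) (⇔-trans (mk⇔ to from) A-positive)
  where
  to : (∃ λ c → 0 < idMat a c × 0 < A n c b) → 0 < A n a b
  to (c , 0<Iac , 0<Acb) =
    subst (λ c → 0 < A n c b) (sym (Equivalence.to (indicator-positive (vec-≡-dec _≟B_ a c)) 0<Iac)) 0<Acb
  from : 0 < A n a b → ∃ λ c → 0 < idMat a c × 0 < A n c b
  from 0<Aab = a , Equivalence.from (indicator-positive (vec-≡-dec _≟B_ a a)) refl , 0<Aab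
power-positive {n} (suc m) {a} {b} = ⇔-trans (⊗-positive {M = A n ^^ suc m} {A n}) (mk⇔ to from)
  where
  to : (∃ λ c → 0 < (A n ^^ suc m) a c × 0 < A n c b) → ZeroMatch (suc (suc m)) a b
  to (c , 0<Aᵐac , 0<Acb) =
    ZeroMatch-trans (Equivalence.to (power-positive m) 0<Aᵐac) (Equivalence.to A-positive 0<Acb)
  from : ZeroMatch (suc (suc m)) a b → ∃ λ c → 0 < (A n ^^ suc m) a c × 0 < A n c b
  from s with ZeroMatch-split {k = 1} s
  ... | c , s₁ , s₂ = c , Equivalence.from (power-positive m) s₁ , Equivalence.from A-positive s₂

lemma5p24 : (n m : ℕ) → 1 ≤ n → 1 ≤ m → (a b : Vec Bool n) →
    ((0 < (A n ^^ m) a b) → (0 < (A n ^^ suc m) a b))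
    × ((0 < (A n ^^ m) a b) ⇔ ∃ (λ z → z ≤ m × ZDom z (toℕVec a) (toℕVec b)))
lemma5p24 n zero _ () a b
lemma5p24 n (suc m) _ 1≤m a b =
  Equivalence.from (power-positive (suc m) {a} {b}) ∘ ZeroMatch-mono (n≤1+n _) ∘ Equivalence.to (power-positive m)
  , ⇔-trans (power-positive m) (ZeroMatch⇔ZDom 1≤m)
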